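{- For all $\Sigma\cup\{\alpha\}\subseteq\mathit{Fm}$, $\Sigma\models_{\mathrm{IPWK}}\alpha$ if and only if there is $\Delta\subseteq\Sigma$ such that $\mathrm{var}(\Delta)\subseteq\mathrm{var}(\alpha)$ and $\Delta\vdash_{\mathrm{IPC}}\alpha$. Moreover, such a $\Delta\subseteq\Sigma$ can be chosen finite.
   Context: Formulas $\mathit{Fm}$ are built over a countably infinite set $V$ of variables in the language $\mathcal{L}=\{\land,\lor,\longrightarrow,\neg,0,1\}$ (arities $2,2,2,1,0,0$); $\vdash_{\mathrm{IPC}}$ is the consequence relation of intuitionistic propositional logic. Heyting algebras are regarded as $\mathcal{L}$-algebras. For a Heyting algebra $\mathbf{H}$ with universe $H$, the extended Heyting algebra $\mathbf{H}^\#=\mathbf{H}\oplus\mathbf{1}$ has universe $H\cup\{\omega\}$ ($\omega\notin H$), constants $0,1$ interpreted as in $\mathbf{H}$, and each operation of arity $n\ge1$ given by $f(a_1,\ldots,a_n)=f^{\mathbf{H}}(a_1,\ldots,a_n)$ if all $a_i\in H$ and $=\omega$ otherwise. $\Sigma\models_{\mathrm{IPWK}}\alpha$ iff for every Heyting algebra $\mathbf{H}$ and every homomorphism (valuation) $v^\#:\mathbf{Fm}\to\mathbf{H}^\#$, $v^\#[\Sigma]\subseteq\{1,\omega\}$ implies $v^\#(\alpha)\in\{1,\omega\}$. $\mathrm{var}(\varphi)$ is the set of variables of $\varphi$, $\mathrm{var}(\Delta)=\bigcup_{\delta\in\Delta}\mathrm{var}(\delta)$. -}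

module Defs where

open import Level using (Level; _⊔_) renaming (suc to lsuc; zero to lzero)
open import Data.Nat using (ℕ)
open import Data.List using (List; []; _∷_; _++_)
open import Data.List.Membership.Propositional using (_∈_)
open import Data.Maybe using (Maybe; just; nothing)
open import Relation.Binary.Lattice.Bundles using (HeytingAlgebra)
open import Relation.Binary.PropositionalEquality using (_≡_)
open import Data.Product using (Σ; ∃; _×_)
open import Data.Unit.Polymorphic using () renaming (⊤ to ⊤′)

infixr 6 _⟶_
infixr 7 _∨ᶠ_
infixr 8 _∧ᶠ_

data Fm : Set where
  var   : ℕ → Fm
  _∧ᶠ_  : Fm → Fm → Fm
  _∨ᶠ_  : Fm → Fm → Fm
  _⟶_   : Fm → Fm → Fm
  ¬ᶠ_   : Fm → Fm
  𝟎     : Fm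
  𝟏     : Fm

FmSet : Set₁
FmSet = Fm → Set

_⊆_ : FmSet → FmSet → Set
Δ ⊆ Γ = ∀ {φ} → Δ φ → Γ φ

vars : Fm → List ℕ
vars (var x)  = x ∷ []
vars (φ ∧ᶠ ψ) = vars φ ++ vars ψ
vars (φ ∨ᶠ ψ) = vars φ ++ vars ψ
vars (φ ⟶ ψ)  = vars φ ++ vars ψ
vars (¬ᶠ φ)   = vars φ
vars 𝟎        = []
vars 𝟏        = []

VarsIncl : FmSet → Fm → Set
VarsIncl Δ α = ∀ {δ} → Δ δ → ∀ {x} → x ∈ vars δ → x ∈ vars α

infix 4 _⊢_

data _⊢_ (Γ : FmSet) : Fm → Set where
  assum : ∀ {φ} → Γ φ → Γ ⊢ φ
  ax-K  : ∀ {φ ψ} → Γ ⊢ φ ⟶ (ψ ⟶ φ)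
  ax-S  : ∀ {φ ψ χ} → Γ ⊢ (φ ⟶ (ψ ⟶ χ)) ⟶ ((φ ⟶ ψ) ⟶ (φ ⟶ χ))
  ax-∧₁ : ∀ {φ ψ} → Γ ⊢ φ ∧ᶠ ψ ⟶ φ
  ax-∧₂ : ∀ {φ ψ} → Γ ⊢ φ ∧ᶠ ψ ⟶ ψ
  ax-∧I : ∀ {φ ψ} → Γ ⊢ φ ⟶ (ψ ⟶ φ ∧ᶠ ψ)
  ax-∨₁ : ∀ {φ ψ} → Γ ⊢ φ ⟶ φ ∨ᶠ ψ
  ax-∨₂ : ∀ {φ ψ} → Γ ⊢ ψ ⟶ φ ∨ᶠ ψ
  ax-∨E : ∀ {φ ψ χ} → Γ ⊢ (φ ⟶ χ) ⟶ ((ψ ⟶ χ) ⟶ (φ ∨ᶠ ψ ⟶ χ))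
  ax-𝟎  : ∀ {φ} → Γ ⊢ 𝟎 ⟶ φ
  ax-𝟏  : Γ ⊢ 𝟏
  ax-¬₁ : ∀ {φ} → Γ ⊢ ¬ᶠ φ ⟶ (φ ⟶ 𝟎)
  ax-¬₂ : ∀ {φ} → Γ ⊢ (φ ⟶ 𝟎) ⟶ ¬ᶠ φ
  mp    : ∀ {φ ψ} → Γ ⊢ φ ⟶ ψ → Γ ⊢ φ → Γ ⊢ ψ

⟨_⟩ : List Fm → FmSet
⟨ Δ ⟩ φ = φ ∈ Δ

-- Extended Heyting algebra H# = H ⊕ 1, carrier Maybe H, with
-- nothing playing the role of the absorbing element ω.
-- A Heyting algebra is an L-algebra with ¬a = a ⇨ ⊥, 0 = ⊥, 1 = ⊤.

module Extended {c ℓ₁ ℓ₂ : Level} (H : HeytingAlgebra c ℓ₁ ℓ₂) where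
  open HeytingAlgebra H

  H# : Set c
  H# = Maybe Carrier

  lift₂ : (Carrier → Carrier → Carrier) → H# → H# → H#
  lift₂ f (just a) (just b) = just (f a b)
  lift₂ f _        _        = nothing

  lift₁ : (Carrier → Carrier) → H# → H#
  lift₁ f (just a) = just (f a)
  lift₁ f nothing  = nothing

  ⟦_⟧ : Fm → (ℕ → H#) → H#
  ⟦ var x  ⟧ v = v x
  ⟦ φ ∧ᶠ ψ ⟧ v = lift₂ _∧_ (⟦ φ ⟧ v) (⟦ ψ ⟧ v)
  ⟦ φ ∨ᶠ ψ ⟧ v = lift₂ _∨_ (⟦ φ ⟧ v) (⟦ ψ ⟧ v)
  ⟦ φ ⟶ ψ  ⟧ v = lift₂ _⇨_ (⟦ φ ⟧ v) (⟦ ψ ⟧ v)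
  ⟦ ¬ᶠ φ   ⟧ v = lift₁ (λ a → a ⇨ ⊥) (⟦ φ ⟧ v)
  ⟦ 𝟎      ⟧ v = just ⊥
  ⟦ 𝟏      ⟧ v = just ⊤

  Designated : H# → Set ℓ₁
  Designated (just a) = a ≈ ⊤
  Designated nothing  = ⊤′

IPWK⊨ : (c ℓ₁ ℓ₂ : Level) → FmSet → Fm → Set (lsuc (c ⊔ ℓ₁ ⊔ ℓ₂))
IPWK⊨ c ℓ₁ ℓ₂ Γ α =
  (H : HeytingAlgebra c ℓ₁ ℓ₂) → let open Extended H in
  (v : ℕ → H#) →
  (∀ {σ} → Γ σ → Designated (⟦ σ ⟧ v)) → Designated (⟦ α ⟧ v)

-- If ⟦ α ⟧ v ≠ ω, every variable of α, hence of every premise in Δ, is assigned a value in H, and on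
-- such formulas ⟦_⟧ is ordinary Heyting-algebra evaluation; so Δ ⊢ α gives Γ ⊨ α by soundness of
-- IPC. Conversely, evaluate in the Lindenbaum algebra of Γ ↾ α (the premises whose variables
-- all occur in α), sending each variable of α to its class and every other variable to ω: premises
-- with a foreign variable become ω, the others become 1, so α is designated, i.e. Γ ↾ α ⊢ α.
-- Finiteness then comes from compactness of ⊢.

module Submission where

open import Defs
open import Level using (Level; Lift; lift; lower)
open import Function using (id; _∘_)
open import Data.Nat using (ℕ; _≟_)
open import Data.List using (List; []; _∷_; _++_)
open import Data.List.Membership.Propositional using (_∈_; find)
open import Data.List.Membership.Propositional.Properties using (∈-++⁺ˡ; ∈-++⁺ʳ; ∈-++⁻)
open import Data.List.Membership.DecPropositional _≟_ using (_∈?_)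
open import Data.List.Relation.Binary.Subset.Propositional using () renaming (_⊆_ to _⊆ᴸ_)
open import Data.List.Relation.Unary.Any using (here)
open import Data.List.Relation.Unary.All using (all?)
import Data.List.Relation.Unary.All as All
open import Data.List.Relation.Unary.All.Properties using (¬All⇒Any¬)
open import Data.Maybe using (just; nothing; fromMaybe)
open import Data.Maybe.Properties using (just-injective)
open import Data.Product using (Σ; _×_; _,_; proj₁; proj₂)
open import Data.Sum using (_⊎_; inj₁; inj₂; [_,_]′)
import Data.Sum as Sum
open import Data.Unit.Polymorphic using (tt)
open import Data.Empty using (⊥-elim)
open import Relation.Nullary using (yes; no; ¬_)
open import Relation.Binary.PropositionalEquality using (_≡_; refl; sym; trans; cong; cong₂; subst)
open import Relation.Binary.Lattice.Bundles using (HeytingAlgebra)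
import Relation.Binary.Lattice.Properties.HeytingAlgebra as HeytingProperties

module Evaluation {c ℓ₁ ℓ₂} (H : HeytingAlgebra c ℓ₁ ℓ₂) where
  open HeytingAlgebra H renaming (refl to ≤-refl; trans to ≤-trans)
  open HeytingProperties H using (⇨-eval; y≤x⇨y; ⇨-distribˡ-∨-∧-≥)
  open Extended H

  eval : Fm → (ℕ → Carrier) → Carrier
  eval (var x)  w = w x
  eval (φ ∧ᶠ ψ) w = eval φ w ∧ eval ψ w
  eval (φ ∨ᶠ ψ) w = eval φ w ∨ eval ψ w
  eval (φ ⟶ ψ)  w = eval φ w ⇨ eval ψ w
  eval (¬ᶠ φ)   w = eval φ w ⇨ ⊥
  eval 𝟎        w = ⊥
  eval 𝟏        w = ⊤

  ≤-modusPonens : ∀ {w x y} → w ≤ x ⇨ y → w ≤ x → w ≤ y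
  ≤-modusPonens p q = ≤-trans (∧-greatest p q) ⇨-eval

  ≤⇒⊤≤⇨ : ∀ {x y} → x ≤ y → ⊤ ≤ x ⇨ y
  ≤⇒⊤≤⇨ x≤y = transpose-⇨ (≤-trans (x∧y≤y _ _) x≤y)

  ⇨-S : ∀ {x y z} → x ⇨ (y ⇨ z) ≤ (x ⇨ y) ⇨ (x ⇨ z)
  ⇨-S = transpose-⇨ (transpose-⇨ (≤-modusPonens
    (≤-modusPonens (≤-trans (x∧y≤x _ _) (x∧y≤x _ _)) (x∧y≤y _ _))
    (≤-modusPonens (≤-trans (x∧y≤x _ _) (x∧y≤y _ _)) (x∧y≤y _ _))))

  eval-sound : ∀ {Δ φ} w → (∀ {δ} → Δ δ → ⊤ ≤ eval δ w) → Δ ⊢ φ → ⊤ ≤ eval φ w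
  eval-sound w Δ-valid (assum δ) = Δ-valid δ
  eval-sound w Δ-valid ax-K      = ≤⇒⊤≤⇨ y≤x⇨y
  eval-sound w Δ-valid ax-S      = ≤⇒⊤≤⇨ ⇨-S
  eval-sound w Δ-valid ax-∧₁     = ≤⇒⊤≤⇨ (x∧y≤x _ _)
  eval-sound w Δ-valid ax-∧₂     = ≤⇒⊤≤⇨ (x∧y≤y _ _)
  eval-sound w Δ-valid ax-∧I     = ≤⇒⊤≤⇨ (transpose-⇨ ≤-refl)
  eval-sound w Δ-valid ax-∨₁     = ≤⇒⊤≤⇨ (x≤x∨y _ _)
  eval-sound w Δ-valid ax-∨₂     = ≤⇒⊤≤⇨ (y≤x∨y _ _)
  eval-sound w Δ-valid ax-∨E     = ≤⇒⊤≤⇨ (transpose-⇨ (⇨-distribˡ-∨-∧-≥ _ _ _))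
  eval-sound w Δ-valid ax-𝟎      = ≤⇒⊤≤⇨ (minimum _)
  eval-sound w Δ-valid ax-𝟏      = ≤-refl
  eval-sound w Δ-valid ax-¬₁     = ≤⇒⊤≤⇨ ≤-refl
  eval-sound w Δ-valid ax-¬₂     = ≤⇒⊤≤⇨ ≤-refl
  eval-sound w Δ-valid (mp d e)  = ≤-modusPonens (eval-sound w Δ-valid d) (eval-sound w Δ-valid e)

  ⟦⟧-just : ∀ {v} w φ → (∀ {x} → x ∈ vars φ → v x ≡ just (w x)) → ⟦ φ ⟧ v ≡ just (eval φ w)
  ⟦⟧-just w (var x)  v≡w = v≡w (here refl)
  ⟦⟧-just w (φ ∧ᶠ ψ) v≡w = cong₂ (lift₂ _∧_) (⟦⟧-just w φ (v≡w ∘ ∈-++⁺ˡ)) (⟦⟧-just w ψ (v≡w ∘ ∈-++⁺ʳ (vars φ)))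
  ⟦⟧-just w (φ ∨ᶠ ψ) v≡w = cong₂ (lift₂ _∨_) (⟦⟧-just w φ (v≡w ∘ ∈-++⁺ˡ)) (⟦⟧-just w ψ (v≡w ∘ ∈-++⁺ʳ (vars φ)))
  ⟦⟧-just w (φ ⟶ ψ)  v≡w = cong₂ (lift₂ _⇨_) (⟦⟧-just w φ (v≡w ∘ ∈-++⁺ˡ)) (⟦⟧-just w ψ (v≡w ∘ ∈-++⁺ʳ (vars φ)))
  ⟦⟧-just w (¬ᶠ φ)   v≡w = cong (lift₁ (_⇨ ⊥)) (⟦⟧-just w φ v≡w)
  ⟦⟧-just w 𝟎        v≡w = refl
  ⟦⟧-just w 𝟏        v≡w = refl

  lift₂-nothing : ∀ f {p q} → p ≡ nothing ⊎ q ≡ nothing → lift₂ f p q ≡ nothing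
  lift₂-nothing f             (inj₁ refl) = refl
  lift₂-nothing f {just _}    (inj₂ refl) = refl
  lift₂-nothing f {nothing}   (inj₂ refl) = refl

  ⟦⟧-nothing : ∀ {v x} φ → x ∈ vars φ → v x ≡ nothing → ⟦ φ ⟧ v ≡ nothing
  ⟦⟧-nothing (var x)  (here refl) vx = vx
  ⟦⟧-nothing (φ ∧ᶠ ψ) x∈ vx = lift₂-nothing _∧_
    (Sum.map (λ x∈φ → ⟦⟧-nothing φ x∈φ vx) (λ x∈ψ → ⟦⟧-nothing ψ x∈ψ vx) (∈-++⁻ (vars φ) x∈))
  ⟦⟧-nothing (φ ∨ᶠ ψ) x∈ vx = lift₂-nothing _∨_
    (Sum.map (λ x∈φ → ⟦⟧-nothing φ x∈φ vx) (λ x∈ψ → ⟦⟧-nothing ψ x∈ψ vx) (∈-++⁻ (vars φ) x∈))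
  ⟦⟧-nothing (φ ⟶ ψ)  x∈ vx = lift₂-nothing _⇨_
    (Sum.map (λ x∈φ → ⟦⟧-nothing φ x∈φ vx) (λ x∈ψ → ⟦⟧-nothing ψ x∈ψ vx) (∈-++⁻ (vars φ) x∈))
  ⟦⟧-nothing (¬ᶠ φ)   x∈ vx = cong (lift₁ (_⇨ ⊥)) (⟦⟧-nothing φ x∈ vx)

  ⟦⟧-just⇒defined : ∀ {v a x} φ → ⟦ φ ⟧ v ≡ just a → x ∈ vars φ → v x ≡ just (fromMaybe ⊤ (v x))
  ⟦⟧-just⇒defined {v} {x = x} φ ⟦φ⟧≡a x∈φ with v x in vx
  ... | just _  = refl
  ... | nothing with trans (sym ⟦φ⟧≡a) (⟦⟧-nothing φ x∈φ vx)
  ...   | ()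

  ⊢⇒designated : ∀ {Δ α} v → VarsIncl Δ α → (∀ {δ} → Δ δ → Designated (⟦ δ ⟧ v)) →
                 Δ ⊢ α → Designated (⟦ α ⟧ v)
  ⊢⇒designated {Δ} {α} v Δ⊆α Δ-designated Δ⊢α with ⟦ α ⟧ v in ⟦α⟧≡a
  ... | nothing = tt
  ... | just a  = antisym (maximum a) (subst (⊤ ≤_) eval≡a (eval-sound w Δ-valid Δ⊢α))
    where
    w : ℕ → Carrier
    w = fromMaybe ⊤ ∘ v

    α-defined : ∀ {x} → x ∈ vars α → v x ≡ just (w x)
    α-defined = ⟦⟧-just⇒defined α ⟦α⟧≡a

    eval≡a : eval α w ≡ a
    eval≡a = just-injective (trans (sym (⟦⟧-just w α α-defined)) ⟦α⟧≡a)

    Δ-valid : ∀ {δ} → Δ δ → ⊤ ≤ eval δ w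
    Δ-valid {δ} δ∈Δ = reflexive (Eq.sym (subst Designated (⟦⟧-just w δ (α-defined ∘ Δ⊆α δ∈Δ)) (Δ-designated δ∈Δ)))

infixl 5 _▸_

_▸_ : FmSet → Fm → FmSet
(Γ ▸ φ) ψ = ψ ≡ φ ⊎ Γ ψ

_↾_ : FmSet → Fm → FmSet
(Γ ↾ α) σ = Γ σ × vars σ ⊆ᴸ vars α

⊢-induction : ∀ {Γ} (P : Fm → Set) →
  (∀ {φ} → Γ φ → P φ) →
  (∀ {φ} → (∀ {Δ} → Δ ⊢ φ) → P φ) →
  (∀ {φ ψ} → P (φ ⟶ ψ) → P φ → P ψ) →
  ∀ {φ} → Γ ⊢ φ → P φ
⊢-induction {Γ} P assumption theorem modusPonens = go
  where
  go : ∀ {φ} → Γ ⊢ φ → P φ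
  go (assum γ) = assumption γ
  go ax-K      = theorem ax-K
  go ax-S      = theorem ax-S
  go ax-∧₁     = theorem ax-∧₁
  go ax-∧₂     = theorem ax-∧₂
  go ax-∧I     = theorem ax-∧I
  go ax-∨₁     = theorem ax-∨₁
  go ax-∨₂     = theorem ax-∨₂
  go ax-∨E     = theorem ax-∨E
  go ax-𝟎      = theorem ax-𝟎
  go ax-𝟏      = theorem ax-𝟏
  go ax-¬₁     = theorem ax-¬₁
  go ax-¬₂     = theorem ax-¬₂
  go (mp d e)  = modusPonens (go d) (go e)

weaken : ∀ {Γ Γ′ φ} → Γ ⊆ Γ′ → Γ ⊢ φ → Γ′ ⊢ φ
weaken {Γ′ = Γ′} Γ⊆Γ′ = ⊢-induction (Γ′ ⊢_) (assum ∘ Γ⊆Γ′) (λ ⊢φ → ⊢φ) mp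

compactness : ∀ {Γ φ} → Γ ⊢ φ → Σ (List Fm) λ L → (⟨ L ⟩ ⊆ Γ) × (⟨ L ⟩ ⊢ φ)
compactness {Γ} = ⊢-induction (λ φ → Σ (List Fm) λ L → (⟨ L ⟩ ⊆ Γ) × (⟨ L ⟩ ⊢ φ))
  (λ {φ} γ → φ ∷ [] , (λ { (here refl) → γ }) , assum (here refl))
  (λ ⊢φ → [] , (λ ()) , ⊢φ)
  λ { (L₁ , L₁⊆Γ , d) (L₂ , L₂⊆Γ , e) →
        L₁ ++ L₂ , [ L₁⊆Γ , L₂⊆Γ ]′ ∘ ∈-++⁻ L₁ ,
        mp (weaken ∈-++⁺ˡ d) (weaken (∈-++⁺ʳ L₁) e) }

⟶-refl : ∀ {Γ φ} → Γ ⊢ φ ⟶ φ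
⟶-refl {φ = φ} = mp (mp ax-S ax-K) (ax-K {ψ = φ})

⊢-const : ∀ {Γ φ ψ} → Γ ⊢ φ → Γ ⊢ ψ ⟶ φ
⊢-const = mp ax-K

deduction : ∀ {Γ φ ψ} → (Γ ▸ φ) ⊢ ψ → Γ ⊢ φ ⟶ ψ
deduction {Γ} {φ} = ⊢-induction (λ ψ → Γ ⊢ φ ⟶ ψ) assumption (λ ⊢ψ → ⊢-const ⊢ψ) (mp ∘ mp ax-S)
  where
  assumption : ∀ {ψ} → (Γ ▸ φ) ψ → Γ ⊢ φ ⟶ ψ
  assumption (inj₁ refl) = ⟶-refl
  assumption (inj₂ γ)    = ⊢-const (assum γ)

wk : ∀ {Γ φ ψ} → Γ ⊢ φ → (Γ ▸ ψ) ⊢ φ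
wk = weaken inj₂

hyp₀ : ∀ {Γ φ} → (Γ ▸ φ) ⊢ φ
hyp₀ = assum (inj₁ refl)

hyp₁ : ∀ {Γ φ ψ} → (Γ ▸ φ ▸ ψ) ⊢ φ
hyp₁ = assum (inj₂ (inj₁ refl))

⟶-trans : ∀ {Γ φ ψ χ} → Γ ⊢ φ ⟶ ψ → Γ ⊢ ψ ⟶ χ → Γ ⊢ φ ⟶ χ
⟶-trans f g = deduction (mp (wk g) (mp (wk f) hyp₀))

∨-least : ∀ {Γ φ ψ χ} → Γ ⊢ φ ⟶ χ → Γ ⊢ ψ ⟶ χ → Γ ⊢ φ ∨ᶠ ψ ⟶ χ
∨-least f g = mp (mp ax-∨E f) g

∧-greatest : ∀ {Γ φ ψ χ} → Γ ⊢ χ ⟶ φ → Γ ⊢ χ ⟶ ψ → Γ ⊢ χ ⟶ φ ∧ᶠ ψ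
∧-greatest f g = deduction (mp (mp ax-∧I (mp (wk f) hyp₀)) (mp (wk g) hyp₀))

curry : ∀ {Γ φ ψ χ} → Γ ⊢ φ ∧ᶠ ψ ⟶ χ → Γ ⊢ φ ⟶ ψ ⟶ χ
curry f = deduction (deduction (mp (wk (wk f)) (mp (mp ax-∧I hyp₁) hyp₀)))

uncurry : ∀ {Γ φ ψ χ} → Γ ⊢ φ ⟶ ψ ⟶ χ → Γ ⊢ φ ∧ᶠ ψ ⟶ χ
uncurry f = deduction (mp (mp (wk f) (mp ax-∧₁ hyp₀)) (mp ax-∧₂ hyp₀))

∧-mono : ∀ {Γ φ φ′ ψ ψ′} → Γ ⊢ φ ⟶ φ′ → Γ ⊢ ψ ⟶ ψ′ → Γ ⊢ φ ∧ᶠ ψ ⟶ φ′ ∧ᶠ ψ′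
∧-mono f g = ∧-greatest (⟶-trans ax-∧₁ f) (⟶-trans ax-∧₂ g)

∨-mono : ∀ {Γ φ φ′ ψ ψ′} → Γ ⊢ φ ⟶ φ′ → Γ ⊢ ψ ⟶ ψ′ → Γ ⊢ φ ∨ᶠ ψ ⟶ φ′ ∨ᶠ ψ′
∨-mono f g = ∨-least (⟶-trans f ax-∨₁) (⟶-trans g ax-∨₂)

⟶-mono : ∀ {Γ φ φ′ ψ ψ′} → Γ ⊢ φ′ ⟶ φ → Γ ⊢ ψ ⟶ ψ′ → Γ ⊢ (φ ⟶ ψ) ⟶ (φ′ ⟶ ψ′)
⟶-mono f g = deduction (deduction (mp (wk (wk g)) (mp hyp₁ (mp (wk (wk f)) hyp₀))))

infix 4 _⊢_⇔_

_⊢_⇔_ : FmSet → Fm → Fm → Set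
Γ ⊢ φ ⇔ ψ = (Γ ⊢ φ ⟶ ψ) × (Γ ⊢ ψ ⟶ φ)

⇔-refl : ∀ {Γ φ} → Γ ⊢ φ ⇔ φ
⇔-refl = ⟶-refl , ⟶-refl

⇔-sym : ∀ {Γ φ ψ} → Γ ⊢ φ ⇔ ψ → Γ ⊢ ψ ⇔ φ
⇔-sym (f , g) = g , f

⇔-trans : ∀ {Γ φ ψ χ} → Γ ⊢ φ ⇔ ψ → Γ ⊢ ψ ⇔ χ → Γ ⊢ φ ⇔ χ
⇔-trans (f , f′) (g , g′) = ⟶-trans f g , ⟶-trans g′ f′

∧-cong : ∀ {Γ φ φ′ ψ ψ′} → Γ ⊢ φ ⇔ φ′ → Γ ⊢ ψ ⇔ ψ′ → Γ ⊢ φ ∧ᶠ ψ ⇔ φ′ ∧ᶠ ψ′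
∧-cong (f , f′) (g , g′) = ∧-mono f g , ∧-mono f′ g′

∨-cong : ∀ {Γ φ φ′ ψ ψ′} → Γ ⊢ φ ⇔ φ′ → Γ ⊢ ψ ⇔ ψ′ → Γ ⊢ φ ∨ᶠ ψ ⇔ φ′ ∨ᶠ ψ′
∨-cong (f , f′) (g , g′) = ∨-mono f g , ∨-mono f′ g′

⟶-cong : ∀ {Γ φ φ′ ψ ψ′} → Γ ⊢ φ ⇔ φ′ → Γ ⊢ ψ ⇔ ψ′ → Γ ⊢ (φ ⟶ ψ) ⇔ (φ′ ⟶ ψ′)
⟶-cong (f , f′) (g , g′) = ⟶-mono f′ g , ⟶-mono f g′

¬-cong : ∀ {Γ φ φ′} → Γ ⊢ φ ⇔ φ′ → Γ ⊢ ¬ᶠ φ ⇔ φ′ ⟶ 𝟎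
¬-cong φ⇔φ′ = ⇔-trans (ax-¬₁ , ax-¬₂) (⟶-cong φ⇔φ′ ⇔-refl)

module Lindenbaum (c ℓ₁ ℓ₂ : Level) (Δ : FmSet) where
  algebra : HeytingAlgebra c ℓ₁ ℓ₂
  algebra = record
    { Carrier = Lift c Fm
    ; _≈_     = λ a b → Lift ℓ₁ (Δ ⊢ lower a ⇔ lower b)
    ; _≤_     = λ a b → Lift ℓ₂ (Δ ⊢ lower a ⟶ lower b)
    ; _∨_     = λ a b → lift (lower a ∨ᶠ lower b)
    ; _∧_     = λ a b → lift (lower a ∧ᶠ lower b)
    ; _⇨_     = λ a b → lift (lower a ⟶ lower b)
    ; ⊤       = lift 𝟏
    ; ⊥       = lift 𝟎
    ; isHeytingAlgebra = record
      { isBoundedLattice = record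
        { isLattice = record
          { isPartialOrder = record
            { isPreorder = record
              { isEquivalence = record
                { refl  = lift ⇔-refl
                ; sym   = λ (lift a⇔b) → lift (⇔-sym a⇔b)
                ; trans = λ (lift a⇔b) (lift b⇔c) → lift (⇔-trans a⇔b b⇔c)
                }
              ; reflexive = λ (lift (a⟶b , _)) → lift a⟶b
              ; trans     = λ (lift a⟶b) (lift b⟶c) → lift (⟶-trans a⟶b b⟶c)
              }
            ; antisym = λ (lift a⟶b) (lift b⟶a) → lift (a⟶b , b⟶a)
            }
          ; supremum = λ _ _ → lift ax-∨₁ , lift ax-∨₂ , λ _ (lift f) (lift g) → lift (∨-least f g)
          ; infimum  = λ _ _ → lift ax-∧₁ , lift ax-∧₂ , λ _ (lift f) (lift g) → lift (∧-greatest f g)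
          }
        ; maximum = λ _ → lift (⊢-const ax-𝟏)
        ; minimum = λ _ → lift ax-𝟎
        }
      ; exponential = λ _ _ _ → (λ (lift f) → lift (curry f)) , (λ (lift g) → lift (uncurry g))
      }
    }

  open HeytingAlgebra algebra using (_≈_; ⊤)
  open Evaluation algebra using (eval)

  generic : ℕ → Lift c Fm
  generic = lift ∘ var

  eval-generic-⇔ : ∀ φ → Δ ⊢ lower (eval φ generic) ⇔ φ
  eval-generic-⇔ (var x)  = ⇔-refl
  eval-generic-⇔ (φ ∧ᶠ ψ) = ∧-cong (eval-generic-⇔ φ) (eval-generic-⇔ ψ)
  eval-generic-⇔ (φ ∨ᶠ ψ) = ∨-cong (eval-generic-⇔ φ) (eval-generic-⇔ ψ)
  eval-generic-⇔ (φ ⟶ ψ)  = ⟶-cong (eval-generic-⇔ φ) (eval-generic-⇔ ψ)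
  eval-generic-⇔ (¬ᶠ φ)   = ⇔-sym (¬-cong (⇔-sym (eval-generic-⇔ φ)))
  eval-generic-⇔ 𝟎        = ⇔-refl
  eval-generic-⇔ 𝟏        = ⇔-refl

  ⊢⇒eval-generic≈⊤ : ∀ {φ} → Δ ⊢ φ → eval φ generic ≈ ⊤
  ⊢⇒eval-generic≈⊤ {φ} ⊢φ = lift (⊢-const ax-𝟏 , ⊢-const (mp (proj₂ (eval-generic-⇔ φ)) ⊢φ))

  eval-generic≈⊤⇒⊢ : ∀ {φ} → eval φ generic ≈ ⊤ → Δ ⊢ φ
  eval-generic≈⊤⇒⊢ {φ} (lift (_ , 𝟏⟶φ)) = mp (proj₁ (eval-generic-⇔ φ)) (mp 𝟏⟶φ ax-𝟏)

module Completeness (c ℓ₁ ℓ₂ : Level) (Γ : FmSet) (α : Fm) where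
  open Lindenbaum c ℓ₁ ℓ₂ (Γ ↾ α)
  open Evaluation algebra using (eval; ⟦⟧-just; ⟦⟧-nothing)
  open Extended algebra

  valuation : ℕ → H#
  valuation x with x ∈? vars α
  ... | yes _ = just (generic x)
  ... | no _  = nothing

  valuation-∈ : ∀ {x} → x ∈ vars α → valuation x ≡ just (generic x)
  valuation-∈ {x} x∈α with x ∈? vars α
  ... | yes _   = refl
  ... | no x∉α = ⊥-elim (x∉α x∈α)

  valuation-∉ : ∀ {x} → ¬ x ∈ vars α → valuation x ≡ nothing
  valuation-∉ {x} x∉α with x ∈? vars α
  ... | yes x∈α = ⊥-elim (x∉α x∈α)
  ... | no _    = refl

  ⟦⟧-valuation : ∀ φ → vars φ ⊆ᴸ vars α → ⟦ φ ⟧ valuation ≡ just (eval φ generic)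
  ⟦⟧-valuation φ φ⊆α = ⟦⟧-just generic φ (valuation-∈ ∘ φ⊆α)

  Γ-designated : ∀ {σ} → Γ σ → Designated (⟦ σ ⟧ valuation)
  Γ-designated {σ} σ∈Γ with all? (_∈? vars α) (vars σ)
  ... | yes σ⊆α = subst Designated (sym (⟦⟧-valuation σ (All.lookup σ⊆α)))
                    (⊢⇒eval-generic≈⊤ (assum (σ∈Γ , All.lookup σ⊆α)))
  ... | no σ⊈α with find (¬All⇒Any¬ (_∈? vars α) (vars σ) σ⊈α)
  ...   | x , x∈σ , x∉α = subst Designated (sym (⟦⟧-nothing σ x∈σ (valuation-∉ x∉α))) tt

  IPWK⊨⇒⊢ : IPWK⊨ c ℓ₁ ℓ₂ Γ α → (Γ ↾ α) ⊢ α
  IPWK⊨⇒⊢ Γ⊨α = eval-generic≈⊤⇒⊢ (subst Designated (⟦⟧-valuation α id) (Γ⊨α algebra valuation Γ-designated))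

⊢⇒IPWK⊨ : ∀ {c ℓ₁ ℓ₂ Γ Δ α} → Δ ⊆ Γ → VarsIncl Δ α → Δ ⊢ α → IPWK⊨ c ℓ₁ ℓ₂ Γ α
⊢⇒IPWK⊨ Δ⊆Γ Δ⊆α Δ⊢α H v Γ-designated = Evaluation.⊢⇒designated H v Δ⊆α (Γ-designated ∘ Δ⊆Γ) Δ⊢α

theorem4p6 : {c ℓ₁ ℓ₂ : Level} (Γ : FmSet) (α : Fm) →
    -- Σ ⊨ α  ⇒  ∃ Δ ⊆ Σ, var(Δ) ⊆ var(α), Δ ⊢ α
    (IPWK⊨ c ℓ₁ ℓ₂ Γ α →
      Σ FmSet (λ Δ → (Δ ⊆ Γ) × VarsIncl Δ α × (Δ ⊢ α)))
    ×
    -- ∃ Δ ⊆ Σ, var(Δ) ⊆ var(α), Δ ⊢ α  ⇒  Σ ⊨ α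
    (Σ FmSet (λ Δ → (Δ ⊆ Γ) × VarsIncl Δ α × (Δ ⊢ α)) →
      IPWK⊨ c ℓ₁ ℓ₂ Γ α)
    ×
    -- moreover, Δ can be chosen finite
    (IPWK⊨ c ℓ₁ ℓ₂ Γ α →
      Σ (List Fm) (λ Δ → (⟨ Δ ⟩ ⊆ Γ) × VarsIncl ⟨ Δ ⟩ α × (⟨ Δ ⟩ ⊢ α)))
theorem4p6 {c} {ℓ₁} {ℓ₂} Γ α =
  (λ Γ⊨α → Γ ↾ α , proj₁ , proj₂ , IPWK⊨⇒⊢ Γ⊨α) ,
  (λ (_ , Δ⊆Γ , Δ⊆α , Δ⊢α) → ⊢⇒IPWK⊨ Δ⊆Γ Δ⊆α Δ⊢α) ,
  (λ Γ⊨α → finite (compactness (IPWK⊨⇒⊢ Γ⊨α)))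
  where
  open Completeness c ℓ₁ ℓ₂ Γ α

  finite : Σ (List Fm) (λ L → (⟨ L ⟩ ⊆ (Γ ↾ α)) × (⟨ L ⟩ ⊢ α)) →
           Σ (List Fm) (λ L → (⟨ L ⟩ ⊆ Γ) × VarsIncl ⟨ L ⟩ α × (⟨ L ⟩ ⊢ α))
  finite (L , L⊆Γ↾α , L⊢α) = L , proj₁ ∘ L⊆Γ↾α , proj₂ ∘ L⊆Γ↾α , L⊢α
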